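{- Let $m\ge n$ and let $S$ be a subset of $[m]$ with $|S|\geq n$. Then the concentration map $\phi_S^{[m]}:\mathcal{F}_n^{[m]}\to\mathcal{F}_n^{S}$ is a contraction, and it induces a simplicial map $\mathcal{VR}(\mathcal{F}_n^{[m]};r)\to\mathcal{VR}(\mathcal{F}_n^{S};r)$ for every $r\geq 0$.
   Context: For $U\subseteq[m]$ with $|U|\ge n$, $\mathcal{F}_n^{U}$ is the set of $n$-element subsets of $U$ with metric $d(A,B)=|A\triangle B|$. The concentration map $\phi_S^{[m]}$ sends $A$ to the union of $A\cap S$ with the $|A\setminus S|$ smallest elements of $S\setminus A$. A map $f:X\to Y$ onto a subspace $Y\subseteq X$ is a contraction if $f|_Y=\mathrm{id}_Y$ and $d(f(x),f(y))\le d(x,y)$ for all $x,y\in X$. $\mathcal{VR}(X;r)$ is the simplicial complex on $X$ whose simplices are nonempty finite sets of pairwise distance $\le r$. -}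

module Defs where

open import Data.Nat using (ℕ; zero; suc; _≤_)
open import Data.Bool using (true; false)
open import Data.Vec using (Vec; []; _∷_)
open import Data.Fin.Subset using (Subset; inside; outside; _∩_; _∪_; _─_; ∣_∣; _⊆_)
open import Data.List using (List; map)
open import Data.List.Relation.Unary.All using (All)
open import Data.List.Relation.Unary.AllPairs using (AllPairs)
open import Data.List.Relation.Unary.Unique.Propositional using (Unique)
open import Data.List.Relation.Unary.Any using (Any)
open import Data.Product using (_×_)
open import Data.Unit using (⊤)
open import Relation.Binary.PropositionalEquality using (_≡_)

-- [m] = {1,…,m} is modelled by Fin m (element i ↔ i+1, same order);
-- a subset of [m] is a characteristic vector  Subset m = Vec Bool m.

dist : ∀ {m} → Subset m → Subset m → ℕ
dist A B = ∣ (A ─ B) ∪ (B ─ A) ∣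

InF : ∀ {m} → ℕ → Subset m → Subset m → Set
InF n U A = (A ⊆ U) × (∣ A ∣ ≡ n)

-- smallest k T : the set of the k smallest elements of T
-- (all of T if |T| < k; never happens where it is used)
smallest : ∀ {m} → ℕ → Subset m → Subset m
smallest k       []             = []
smallest zero    (x ∷ T)        = outside ∷ smallest zero T
smallest (suc k) (false ∷ T)    = outside ∷ smallest (suc k) T
smallest (suc k) (true ∷ T)     = inside ∷ smallest k T

φ : ∀ {m} → Subset m → Subset m → Subset m
φ S A = (A ∩ S) ∪ smallest ∣ A ─ S ∣ (S ─ A)

IsContraction : ∀ {m} → ℕ → Subset m → Subset m → (Subset m → Subset m) → Set
IsContraction n X Y f =
  (∀ A → InF n X A → InF n Y (f A)) ×
  (∀ A → InF n Y A → f A ≡ A) ×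
  (∀ A B → InF n X A → InF n X B → dist (f A) (f B) ≤ dist A B)

-- simplices of VR(F_n^U; r): nonempty finite sets (duplicate-free lists)
-- of vertices of F_n^U with pairwise distance ≤ r
NonEmpty : ∀ {m} → List (Subset m) → Set
NonEmpty xs = Any (λ _ → ⊤) xs

IsVRSimplex : ∀ {m} → ℕ → Subset m → ℕ → List (Subset m) → Set
IsVRSimplex n U r σ =
  NonEmpty σ × Unique σ × All (InF n U) σ × AllPairs (λ A B → dist A B ≤ r) σ

-- f induces a simplicial map VR(F_n^X; r) → VR(F_n^Y; r): f sends vertices
-- to vertices, and for every simplex σ the image vertex set f(σ) is a simplex.
-- f(σ) is the list (map f σ) with duplicates removed; the simplex conditions
-- (nonempty, vertices in F_n^Y, pairwise distance ≤ r) are insensitive to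
-- duplicates (d(A,A)=0), so they are stated directly on (map f σ).
IsSimplicialVR : ∀ {m} → ℕ → Subset m → Subset m → ℕ → (Subset m → Subset m) → Set
IsSimplicialVR n X Y r f =
  (∀ A → InF n X A → InF n Y (f A)) ×
  (∀ σ → IsVRSimplex n X r σ →
     NonEmpty (map f σ) × All (InF n Y) (map f σ) × AllPairs (λ A B → dist A B ≤ r) (map f σ))

-- Split A △ B into its parts inside and outside S. On S, φ S A keeps A ∩ S and
-- fills the k = |A ∖ S| smallest holes of S ∖ A, and likewise for B with
-- l = |B ∖ S|. Because both fillings are greedy from the left, they disagree in
-- at most |k − l| ≤ |(A △ B) ∖ S| places beyond (A △ B) ∩ S, so
-- d(φ S A, φ S B) ≤ |(A △ B) ∩ S| + |(A △ B) ∖ S| = d(A, B). A contraction maps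
-- VR-simplices to VR-simplices at the same scale.
module Submission where

open import Defs
open import Data.Nat using (ℕ; zero; suc; _+_; _≤_; z≤n; s≤s)
open import Data.Nat.Properties
  using (≤-trans; ≤-reflexive; n≤1+n; +-suc; +-mono-≤; +-monoʳ-≤; +-cancelˡ-≤; module ≤-Reasoning)
open import Data.Bool using (true; false)
open import Data.Vec using ([]; _∷_; here; there)
open import Data.Fin.Subset using (Subset; ⊤; outside; inside; _∩_; _∪_; _─_; _⊆_; _∈_; ∣_∣)
open import Data.Fin.Subset.Properties using (drop-∷-⊆; ∩-comm; ∪-comm; p∩q⊆q; p─q⊆p; x∈p∪q⁻)
import Data.List.Relation.Unary.All as All
import Data.List.Relation.Unary.All.Properties as All
import Data.List.Relation.Unary.AllPairs as AllPairs
import Data.List.Relation.Unary.AllPairs.Properties as AllPairs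
import Data.List.Relation.Unary.Any.Properties as Any
open import Data.Product using (_×_; _,_)
open import Data.Sum using (inj₁; inj₂)
open import Relation.Binary.PropositionalEquality using (_≡_; refl; sym; trans; cong; cong₂; subst; module ≡-Reasoning)

-- The same sets as `smallest`, but recursing on the subset first, so that it
-- computes on a known head bit even when the count is a variable.
smallest′ : ∀ {m} → ℕ → Subset m → Subset m
smallest′ k       []          = []
smallest′ k       (false ∷ T) = outside ∷ smallest′ k T
smallest′ zero    (true ∷ T)  = outside ∷ smallest′ zero T
smallest′ (suc k) (true ∷ T)  = inside ∷ smallest′ k T

smallest≡smallest′ : ∀ {m} k (T : Subset m) → smallest k T ≡ smallest′ k T
smallest≡smallest′ k       []          = refl
smallest≡smallest′ zero    (false ∷ T) = cong (outside ∷_) (smallest≡smallest′ zero T)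
smallest≡smallest′ zero    (true ∷ T)  = cong (outside ∷_) (smallest≡smallest′ zero T)
smallest≡smallest′ (suc k) (false ∷ T) = cong (outside ∷_) (smallest≡smallest′ (suc k) T)
smallest≡smallest′ (suc k) (true ∷ T)  = cong (inside ∷_) (smallest≡smallest′ k T)

smallest′⊆ : ∀ {m} k (T : Subset m) → smallest′ k T ⊆ T
smallest′⊆ k       (false ∷ T) (there x) = there (smallest′⊆ k T x)
smallest′⊆ zero    (true ∷ T)  (there x) = there (smallest′⊆ zero T x)
smallest′⊆ (suc k) (true ∷ T)  here      = here
smallest′⊆ (suc k) (true ∷ T)  (there x) = there (smallest′⊆ k T x)

concentrate : ∀ {m} → ℕ → Subset m → Subset m → Subset m
concentrate k S A = (A ∩ S) ∪ smallest′ k (S ─ A)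

φ≡concentrate : ∀ {m} (S A : Subset m) → φ S A ≡ concentrate ∣ A ─ S ∣ S A
φ≡concentrate S A = cong ((A ∩ S) ∪_) (smallest≡smallest′ ∣ A ─ S ∣ (S ─ A))

_△_ : ∀ {m} → Subset m → Subset m → Subset m
A △ B = (A ─ B) ∪ (B ─ A)

△-comm : ∀ {m} (A B : Subset m) → A △ B ≡ B △ A
△-comm A B = ∪-comm (A ─ B) (B ─ A)

∣p∣≡∣p∩q∣+∣p─q∣ : ∀ {m} (p q : Subset m) → ∣ p ∣ ≡ ∣ p ∩ q ∣ + ∣ p ─ q ∣
∣p∣≡∣p∩q∣+∣p─q∣ []          []          = refl
∣p∣≡∣p∩q∣+∣p─q∣ (false ∷ p) (true ∷ q)  = ∣p∣≡∣p∩q∣+∣p─q∣ p q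
∣p∣≡∣p∩q∣+∣p─q∣ (false ∷ p) (false ∷ q) = ∣p∣≡∣p∩q∣+∣p─q∣ p q
∣p∣≡∣p∩q∣+∣p─q∣ (true ∷ p)  (true ∷ q)  = cong suc (∣p∣≡∣p∩q∣+∣p─q∣ p q)
∣p∣≡∣p∩q∣+∣p─q∣ (true ∷ p)  (false ∷ q) =
  trans (cong suc (∣p∣≡∣p∩q∣+∣p─q∣ p q)) (sym (+-suc _ _))

∣p─r∣≤∣q─r∣+∣p△q─r∣ : ∀ {m} (p q r : Subset m) → ∣ p ─ r ∣ ≤ ∣ q ─ r ∣ + ∣ (p △ q) ─ r ∣
∣p─r∣≤∣q─r∣+∣p△q─r∣ []          []          []          = z≤n
∣p─r∣≤∣q─r∣+∣p△q─r∣ (_ ∷ p)     (_ ∷ q)     (true ∷ r)  = ∣p─r∣≤∣q─r∣+∣p△q─r∣ p q r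
∣p─r∣≤∣q─r∣+∣p△q─r∣ (true ∷ p)  (true ∷ q)  (false ∷ r) = s≤s (∣p─r∣≤∣q─r∣+∣p△q─r∣ p q r)
∣p─r∣≤∣q─r∣+∣p△q─r∣ (false ∷ p) (false ∷ q) (false ∷ r) = ∣p─r∣≤∣q─r∣+∣p△q─r∣ p q r
∣p─r∣≤∣q─r∣+∣p△q─r∣ (true ∷ p)  (false ∷ q) (false ∷ r) =
  ≤-trans (s≤s (∣p─r∣≤∣q─r∣+∣p△q─r∣ p q r)) (≤-reflexive (sym (+-suc _ _)))
∣p─r∣≤∣q─r∣+∣p△q─r∣ (false ∷ p) (true ∷ q)  (false ∷ r) =
  ≤-trans (∣p─r∣≤∣q─r∣+∣p△q─r∣ p q r) (+-mono-≤ (n≤1+n _) (n≤1+n _))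

m≤1+n+o⇒m≤n+1+o : ∀ {m n o} → m ≤ suc (n + o) → m ≤ n + suc o
m≤1+n+o⇒m≤n+1+o {n = n} {o} p = ≤-trans p (≤-reflexive (sym (+-suc n o)))

1+m≤n+o⇒m≤n+1+o : ∀ {m n o} → suc m ≤ n + o → m ≤ n + suc o
1+m≤n+o⇒m≤n+1+o {m} {n} {o} p = ≤-trans (n≤1+n m) (≤-trans p (+-monoʳ-≤ n (n≤1+n o)))

-- e is a budget bounding the imbalance of the remaining fill counts k and l: a
-- point of (A △ B) ∩ S filled on the side missing it turns its unit of the bound
-- into budget, and a point of S ∖ (A ∪ B) filled on one side only spends one.
dist-concentrate≤ : ∀ {m} (S A B : Subset m) k l e → k ≤ l + e → l ≤ k + e →
                    dist (concentrate k S A) (concentrate l S B) ≤ ∣ (A △ B) ∩ S ∣ + e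
dist-concentrate≤ []          []          []          k l e p q = z≤n
dist-concentrate≤ (false ∷ S) (true ∷ A)  (true ∷ B)  k l e p q = dist-concentrate≤ S A B k l e p q
dist-concentrate≤ (false ∷ S) (true ∷ A)  (false ∷ B) k l e p q = dist-concentrate≤ S A B k l e p q
dist-concentrate≤ (false ∷ S) (false ∷ A) (true ∷ B)  k l e p q = dist-concentrate≤ S A B k l e p q
dist-concentrate≤ (false ∷ S) (false ∷ A) (false ∷ B) k l e p q = dist-concentrate≤ S A B k l e p q
dist-concentrate≤ (true ∷ S)  (true ∷ A)  (true ∷ B)  k l e p q = dist-concentrate≤ S A B k l e p q
dist-concentrate≤ (true ∷ S)  (true ∷ A)  (false ∷ B) k zero e p q =
  s≤s (dist-concentrate≤ S A B k zero e p q)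
dist-concentrate≤ (true ∷ S)  (true ∷ A)  (false ∷ B) k (suc l) e p q =
  ≤-trans (dist-concentrate≤ S A B k l (suc e) (m≤1+n+o⇒m≤n+1+o p) (1+m≤n+o⇒m≤n+1+o q))
          (≤-reflexive (+-suc _ e))
dist-concentrate≤ (true ∷ S)  (false ∷ A) (true ∷ B)  zero l e p q =
  s≤s (dist-concentrate≤ S A B zero l e p q)
dist-concentrate≤ (true ∷ S)  (false ∷ A) (true ∷ B)  (suc k) l e p q =
  ≤-trans (dist-concentrate≤ S A B k l (suc e) (1+m≤n+o⇒m≤n+1+o p) (m≤1+n+o⇒m≤n+1+o q))
          (≤-reflexive (+-suc _ e))
dist-concentrate≤ (true ∷ S)  (false ∷ A) (false ∷ B) zero zero e p q =
  dist-concentrate≤ S A B zero zero e p q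
dist-concentrate≤ (true ∷ S)  (false ∷ A) (false ∷ B) (suc k) (suc l) e (s≤s p) (s≤s q) =
  dist-concentrate≤ S A B k l e p q
dist-concentrate≤ (true ∷ S)  (false ∷ A) (false ∷ B) (suc k) zero (suc e) (s≤s p) q =
  ≤-trans (s≤s (dist-concentrate≤ S A B k zero e p z≤n)) (≤-reflexive (sym (+-suc _ e)))
dist-concentrate≤ (true ∷ S)  (false ∷ A) (false ∷ B) zero (suc l) (suc e) p (s≤s q) =
  ≤-trans (s≤s (dist-concentrate≤ S A B zero l e z≤n q)) (≤-reflexive (sym (+-suc _ e)))

∣concentrate∣≡∣A∩S∣+k : ∀ {m} k (S A : Subset m) → k ≤ ∣ S ─ A ∣ →
                        ∣ concentrate k S A ∣ ≡ ∣ A ∩ S ∣ + k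
∣concentrate∣≡∣A∩S∣+k zero    []          []          _       = refl
∣concentrate∣≡∣A∩S∣+k (suc k) []          []          ()
∣concentrate∣≡∣A∩S∣+k k       (false ∷ S) (true ∷ A)  p       = ∣concentrate∣≡∣A∩S∣+k k S A p
∣concentrate∣≡∣A∩S∣+k k       (false ∷ S) (false ∷ A) p       = ∣concentrate∣≡∣A∩S∣+k k S A p
∣concentrate∣≡∣A∩S∣+k k       (true ∷ S)  (true ∷ A)  p       = cong suc (∣concentrate∣≡∣A∩S∣+k k S A p)
∣concentrate∣≡∣A∩S∣+k zero    (true ∷ S)  (false ∷ A) _       = ∣concentrate∣≡∣A∩S∣+k zero S A z≤n
∣concentrate∣≡∣A∩S∣+k (suc k) (true ∷ S)  (false ∷ A) (s≤s p) =
  trans (cong suc (∣concentrate∣≡∣A∩S∣+k k S A p)) (sym (+-suc _ k))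

concentrate⊆ : ∀ {m} k (S A : Subset m) → concentrate k S A ⊆ S
concentrate⊆ k S A x∈ with x∈p∪q⁻ (A ∩ S) (smallest′ k (S ─ A)) x∈
... | inj₁ x∈A∩S   = p∩q⊆q A S x∈A∩S
... | inj₂ x∈holes = p─q⊆p S A (smallest′⊆ k (S ─ A) x∈holes)

concentrate-id : ∀ {m} {S A : Subset m} → A ⊆ S → concentrate 0 S A ≡ A
concentrate-id {S = []}        {[]}        _ = refl
concentrate-id {S = false ∷ S} {false ∷ A} h = cong (outside ∷_) (concentrate-id (drop-∷-⊆ h))
concentrate-id {S = true ∷ S}  {false ∷ A} h = cong (outside ∷_) (concentrate-id (drop-∷-⊆ h))
concentrate-id {S = true ∷ S}  {true ∷ A}  h = cong (inside ∷_) (concentrate-id (drop-∷-⊆ h))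
concentrate-id {S = false ∷ S} {true ∷ A}  h with h here
... | ()

p⊆q⇒∣p─q∣≡0 : ∀ {m} {p q : Subset m} → p ⊆ q → ∣ p ─ q ∣ ≡ 0
p⊆q⇒∣p─q∣≡0 {p = []}        {[]}        _ = refl
p⊆q⇒∣p─q∣≡0 {p = false ∷ p} {true ∷ q}  h = p⊆q⇒∣p─q∣≡0 (drop-∷-⊆ h)
p⊆q⇒∣p─q∣≡0 {p = false ∷ p} {false ∷ q} h = p⊆q⇒∣p─q∣≡0 (drop-∷-⊆ h)
p⊆q⇒∣p─q∣≡0 {p = true ∷ p}  {true ∷ q}  h = p⊆q⇒∣p─q∣≡0 (drop-∷-⊆ h)
p⊆q⇒∣p─q∣≡0 {p = true ∷ p}  {false ∷ q} h with h here
... | ()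

φ⊆ : ∀ {m} (S A : Subset m) → φ S A ⊆ S
φ⊆ S A x∈ = concentrate⊆ ∣ A ─ S ∣ S A (subst (λ C → _ ∈ C) (φ≡concentrate S A) x∈)

∣p∣≤∣q∣⇒∣p─q∣≤∣q─p∣ : ∀ {m} (p q : Subset m) → ∣ p ∣ ≤ ∣ q ∣ → ∣ p ─ q ∣ ≤ ∣ q ─ p ∣
∣p∣≤∣q∣⇒∣p─q∣≤∣q─p∣ p q ∣p∣≤∣q∣ = +-cancelˡ-≤ (∣ p ∩ q ∣) (∣ p ─ q ∣) (∣ q ─ p ∣) (begin
  ∣ p ∩ q ∣ + ∣ p ─ q ∣  ≡⟨ sym (∣p∣≡∣p∩q∣+∣p─q∣ p q) ⟩
  ∣ p ∣                  ≤⟨ ∣p∣≤∣q∣ ⟩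
  ∣ q ∣                  ≡⟨ ∣p∣≡∣p∩q∣+∣p─q∣ q p ⟩
  ∣ q ∩ p ∣ + ∣ q ─ p ∣  ≡⟨ cong (λ r → ∣ r ∣ + ∣ q ─ p ∣) (∩-comm q p) ⟩
  ∣ p ∩ q ∣ + ∣ q ─ p ∣  ∎)
  where open ≤-Reasoning

∣φ∣≡∣A∣ : ∀ {m} (S A : Subset m) → ∣ A ∣ ≤ ∣ S ∣ → ∣ φ S A ∣ ≡ ∣ A ∣
∣φ∣≡∣A∣ S A ∣A∣≤∣S∣ = begin
  ∣ φ S A ∣                        ≡⟨ cong ∣_∣ (φ≡concentrate S A) ⟩
  ∣ concentrate (∣ A ─ S ∣) S A ∣  ≡⟨ ∣concentrate∣≡∣A∩S∣+k (∣ A ─ S ∣) S A (∣p∣≤∣q∣⇒∣p─q∣≤∣q─p∣ A S ∣A∣≤∣S∣) ⟩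
  ∣ A ∩ S ∣ + ∣ A ─ S ∣            ≡⟨ sym (∣p∣≡∣p∩q∣+∣p─q∣ A S) ⟩
  ∣ A ∣                            ∎
  where open ≡-Reasoning

φ-id : ∀ {m} {S A : Subset m} → A ⊆ S → φ S A ≡ A
φ-id {S = S} {A} A⊆S = trans (φ≡concentrate S A)
  (subst (λ k → concentrate k S A ≡ A) (sym (p⊆q⇒∣p─q∣≡0 A⊆S)) (concentrate-id A⊆S))

φ-contracting : ∀ {m} (S A B : Subset m) → dist (φ S A) (φ S B) ≤ dist A B
φ-contracting S A B = begin
  dist (φ S A) (φ S B)                      ≡⟨ cong₂ dist (φ≡concentrate S A) (φ≡concentrate S B) ⟩
  dist (concentrate k S A) (concentrate l S B)
    ≤⟨ dist-concentrate≤ S A B k l ∣ (A △ B) ─ S ∣ k≤l+e l≤k+e ⟩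
  ∣ (A △ B) ∩ S ∣ + ∣ (A △ B) ─ S ∣         ≡⟨ sym (∣p∣≡∣p∩q∣+∣p─q∣ (A △ B) S) ⟩
  dist A B                                  ∎
  where
  open ≤-Reasoning
  k = ∣ A ─ S ∣
  l = ∣ B ─ S ∣
  k≤l+e : k ≤ l + ∣ (A △ B) ─ S ∣
  k≤l+e = ∣p─r∣≤∣q─r∣+∣p△q─r∣ A B S
  l≤k+e : l ≤ k + ∣ (A △ B) ─ S ∣
  l≤k+e = subst (λ C → l ≤ k + ∣ C ─ S ∣) (△-comm B A) (∣p─r∣≤∣q─r∣+∣p△q─r∣ B A S)

φ-vertex : ∀ {m n} {S A : Subset m} → n ≤ ∣ S ∣ → InF n ⊤ A → InF n S (φ S A)
φ-vertex {S = S} {A} n≤∣S∣ (_ , ∣A∣≡n) =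
  φ⊆ S A , trans (∣φ∣≡∣A∣ S A (subst (_≤ ∣ S ∣) (sym ∣A∣≡n) n≤∣S∣)) ∣A∣≡n

-- The hypothesis n ≤ m is implied by n ≤ ∣ S ∣.
corollary4p3 : (m n : ℕ) → n ≤ m → (S : Subset m) → n ≤ ∣ S ∣ →
    IsContraction n ⊤ S (φ S) × (∀ (r : ℕ) → IsSimplicialVR n ⊤ S r (φ S))
corollary4p3 m n _ S n≤∣S∣ =
  ((λ _ → vertex) , (λ _ (A⊆S , _) → φ-id A⊆S) , (λ A B _ _ → φ-contracting S A B)) ,
  λ r → (λ _ → vertex) , λ σ (nonempty , _ , vertices , close) →
    Any.map⁺ nonempty ,
    All.map⁺ (All.map vertex vertices) ,
    AllPairs.map⁺ (AllPairs.map (λ {A} {B} → ≤-trans (φ-contracting S A B)) close)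
  where
  vertex : ∀ {A} → InF n ⊤ A → InF n S (φ S A)
  vertex = φ-vertex n≤∣S∣
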